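{- Let $m,n$ be positive integers and $d=m+n$. For $i=1,\ldots,d$ let $v_i={\bf e}_i+{\bf e}_{i+1}+\cdots+{\bf e}_{i+m-1}\in\mathbb R^d$, where ${\bf e}_1,\ldots,{\bf e}_d$ are the standard unit vectors and indices are taken modulo $d$ (i.e. ${\bf e}_{d+j}={\bf e}_j$). Let $M$ be the $d\times d$ matrix with rows $v_1,\ldots,v_d$. If $\gcd(m,n)=1$ then $\det M=\pm m$; if $\gcd(m,n)\neq1$ then $\det M=0$. -}

module Defs where

open import Data.Nat as ℕ using (ℕ; zero; suc; _+_; _%_; NonZero; nonZero)
open import Data.Fin using (Fin; toℕ; punchIn) renaming (zero to fzero; suc to fsuc)
open import Data.Integer as ℤ using (ℤ; +_; -_)
open import Data.Bool using (if_then_else_)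
open import Relation.Nullary.Decidable using (⌊_⌋)

-- Square integer matrices of size n, as functions (row, column) ↦ entry.
Matrix : ℕ → Set
Matrix n = Fin n → Fin n → ℤ

sumFin : ∀ {n} → (Fin n → ℤ) → ℤ
sumFin {zero}  f = + 0
sumFin {suc n} f = f fzero ℤ.+ sumFin (λ j → f (fsuc j))

minor : ∀ {n} → Matrix (suc n) → Fin (suc n) → Matrix n
minor M j r c = M (fsuc r) (punchIn j c)

det : ∀ n → Matrix n → ℤ
det zero    M = + 1
det (suc n) M = sumFin (λ j → ((- (+ 1)) ℤ.^ toℕ j) ℤ.* (M fzero j ℤ.* det n (minor M j)))

nonZero-+ : ∀ m n → .{{NonZero m}} → NonZero (m + n)
nonZero-+ (suc m) n = nonZero

δ : ℕ → ℕ → ℤ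
δ a b = if ⌊ a ℕ.≟ b ⌋ then + 1 else + 0

-- Entry (i , j) (0-based) of the matrix M with rows v_i = e_i + e_{i+1} + ⋯ + e_{i+m-1},
-- indices mod d = m + n:  M i j = Σ_{k < m} [ (i + k) mod d ≡ j ].
-- (0-based indexing is a shift of the paper's 1-based one; the matrix is the same.)
circMatrix : (m n : ℕ) → .{{NonZero m}} → Matrix (m + n)
circMatrix m n i j = sumFin {m} (λ k → δ (_%_ (toℕ i + toℕ k) (m + n) {{nonZero-+ m n}}) (toℕ j))

-- Subtracting from every column but the last its cyclic predecessor turns the circulant
-- matrix into one whose column j is e_j − e_{j−m} (indices mod d = m + n), while the
-- entries of the last column sum to m. If gcd(m, n) = 1, then j ↦ j − m is a single
-- d-cycle, so these columns are the edges of a spanning tree rooted at the last vertex.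
-- The determinant of such a weighted incidence matrix is the sum of the weights: clearing
-- the first row by column operations contracts an edge of the tree. Hence det = m (the
-- sign is always +). If g = gcd(m, n) > 1, the columns indexed by the multiples of g avoid
-- the last one and sum to zero, so det = 0.

module Submission where

open import Defs
open import Data.Nat as ℕ using (ℕ; zero; suc; NonZero; _%_)
open import Data.Nat.GCD using (gcd)
import Data.Nat.Properties as ℕP
open import Data.Fin as Fin using (Fin; toℕ; punchIn; punchOut; inject₁; fromℕ; fromℕ<) renaming (zero to fzero; suc to fsuc)
import Data.Fin.Properties as FinP
open import Data.Integer as ℤ using (ℤ; +_; -_; _+_; _*_; _-_)
import Data.Integer.Properties as ℤP
open import Data.Integer.Tactic.RingSolver using (solve-∀)
import Data.Nat.Tactic.RingSolver as ℕ-Solver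
open import Data.Empty using (⊥-elim)
open import Data.Product using (_×_; _,_; ∃-syntax; proj₁; proj₂)
open import Data.Sum using (_⊎_; inj₁; inj₂)
open import Function using (_∘_)
open import Relation.Binary.PropositionalEquality
open import Relation.Binary.Definitions using (tri<; tri≈; tri>)
open import Relation.Nullary using (yes; no; Dec)
open import Algebra.Properties.AbelianGroup ℤP.+-0-abelianGroup using (inverseʳ-unique; identityʳ-unique)

private
  variable
    k n : ℕ

-- Indicators and finite sums

δ-refl : ∀ x → δ x x ≡ + 1
δ-refl x with x ℕ.≟ x
... | yes _   = refl
... | no x≢x = ⊥-elim (x≢x refl)

δ-≢ : ∀ {x y} → x ≢ y → δ x y ≡ + 0
δ-≢ {x} {y} x≢y with x ℕ.≟ y
... | yes x≡y = ⊥-elim (x≢y x≡y)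
... | no _    = refl

δ-cong : ∀ {x y u v} → (x ≡ y → u ≡ v) → (u ≡ v → x ≡ y) → δ x y ≡ δ u v
δ-cong {x} {y} to from with x ℕ.≟ y
... | yes x≡y = sym (trans (cong (δ _) (sym (to x≡y))) (δ-refl _))
... | no x≢y  = sym (δ-≢ (x≢y ∘ from))

δ-suc : ∀ x y → δ (suc x) (suc y) ≡ δ x y
δ-suc x y = δ-cong ℕP.suc-injective (cong suc)

sumFin-cong : {f g : Fin n → ℤ} → (∀ j → f j ≡ g j) → sumFin f ≡ sumFin g
sumFin-cong {zero}  f≗g = refl
sumFin-cong {suc n} f≗g = cong₂ _+_ (f≗g fzero) (sumFin-cong (f≗g ∘ fsuc))

sumFin-distrib-+ : (f g : Fin n → ℤ) → sumFin (λ j → f j + g j) ≡ sumFin f + sumFin g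
sumFin-distrib-+ {zero}  f g = refl
sumFin-distrib-+ {suc n} f g = begin
  f fzero + g fzero + sumFin (λ j → f (fsuc j) + g (fsuc j))
    ≡⟨ cong (λ s → f fzero + g fzero + s) (sumFin-distrib-+ (f ∘ fsuc) (g ∘ fsuc)) ⟩
  f fzero + g fzero + (sumFin (f ∘ fsuc) + sumFin (g ∘ fsuc))
    ≡⟨ interchange (f fzero) (g fzero) _ _ ⟩
  f fzero + sumFin (f ∘ fsuc) + (g fzero + sumFin (g ∘ fsuc)) ∎
  where
  open ≡-Reasoning
  interchange : ∀ a b c d → a + b + (c + d) ≡ a + c + (b + d)
  interchange = solve-∀

sumFin-*ˡ : (a : ℤ) (f : Fin n → ℤ) → sumFin (λ j → a * f j) ≡ a * sumFin f
sumFin-*ˡ {zero}  a f = sym (ℤP.*-zeroʳ a)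
sumFin-*ˡ {suc n} a f =
  trans (cong (λ s → a * f fzero + s) (sumFin-*ˡ a (f ∘ fsuc))) (sym (ℤP.*-distribˡ-+ a _ _))

sumFin-zero : (f : Fin n → ℤ) → (∀ j → f j ≡ + 0) → sumFin f ≡ + 0
sumFin-zero {zero}  f f≗0 = refl
sumFin-zero {suc n} f f≗0 = cong₂ _+_ (f≗0 fzero) (sumFin-zero (f ∘ fsuc) (f≗0 ∘ fsuc))

sumFin-single : (f : Fin n → ℤ) (c : Fin n) → (∀ j → j ≢ c → f j ≡ + 0) → sumFin f ≡ f c
sumFin-single {suc n} f fzero    f≗0 =
  trans (cong (_+_ (f fzero)) (sumFin-zero (f ∘ fsuc) (λ j → f≗0 (fsuc j) λ ()))) (ℤP.+-identityʳ _)
sumFin-single {suc n} f (fsuc c) f≗0 =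
  trans (cong (_+ sumFin (f ∘ fsuc)) (f≗0 fzero λ ()))
        (trans (ℤP.+-identityˡ _) (sumFin-single (f ∘ fsuc) c (λ j j≢c → f≗0 (fsuc j) (j≢c ∘ FinP.suc-injective))))

sumFin-pair : (f : Fin n → ℤ) (a b : Fin n) → a ≢ b → (∀ j → j ≢ a → j ≢ b → f j ≡ + 0) →
              sumFin f ≡ f a + f b
sumFin-pair {suc n} f fzero    fzero    a≢b f≗0 = ⊥-elim (a≢b refl)
sumFin-pair {suc n} f fzero    (fsuc b) a≢b f≗0 =
  cong (_+_ (f fzero)) (sumFin-single (f ∘ fsuc) b λ j j≢b → f≗0 (fsuc j) (λ ()) (j≢b ∘ FinP.suc-injective))
sumFin-pair {suc n} f (fsuc a) fzero    a≢b f≗0 =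
  trans (cong (_+_ (f fzero)) (sumFin-single (f ∘ fsuc) a λ j j≢a → f≗0 (fsuc j) (j≢a ∘ FinP.suc-injective) (λ ())))
        (ℤP.+-comm (f fzero) (f (fsuc a)))
sumFin-pair {suc n} f (fsuc a) (fsuc b) a≢b f≗0 =
  trans (cong (_+ sumFin (f ∘ fsuc)) (f≗0 fzero (λ ()) (λ ())))
        (trans (ℤP.+-identityˡ _)
               (sumFin-pair (f ∘ fsuc) a b (a≢b ∘ cong fsuc)
                            λ j j≢a j≢b → f≗0 (fsuc j) (j≢a ∘ FinP.suc-injective) (j≢b ∘ FinP.suc-injective)))

sumFin-distrib-− : (f g : Fin n → ℤ) → sumFin (λ j → f j - g j) ≡ sumFin f - sumFin g
sumFin-distrib-− f g = begin
  sumFin (λ j → f j - g j)               ≡⟨ sumFin-distrib-+ f (λ j → - g j) ⟩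
  sumFin f + sumFin (λ j → - g j)        ≡⟨ cong (_+_ (sumFin f)) (sumFin-cong λ j → sym (ℤP.-1*i≡-i (g j))) ⟩
  sumFin f + sumFin (λ j → - + 1 * g j)  ≡⟨ cong (_+_ (sumFin f)) (trans (sumFin-*ˡ (- + 1) g) (ℤP.-1*i≡-i (sumFin g))) ⟩
  sumFin f - sumFin g                    ∎
  where open ≡-Reasoning

sumFin-telescope : ∀ k (g : ℕ → ℤ) x → sumFin {k} (λ t → g (x ℕ.+ toℕ t) - g (suc (x ℕ.+ toℕ t))) ≡ g x - g (x ℕ.+ k)
sumFin-telescope zero    g x = sym (trans (cong (λ y → g x - g y) (ℕP.+-identityʳ x)) (ℤP.+-inverseʳ (g x)))
sumFin-telescope (suc k) g x = begin
  g (x ℕ.+ 0) - g (suc (x ℕ.+ 0)) + sumFin {k} (λ t → g (x ℕ.+ suc (toℕ t)) - g (suc (x ℕ.+ suc (toℕ t))))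
    ≡⟨ cong₂ _+_ (cong (λ y → g y - g (suc y)) (ℕP.+-identityʳ x))
                 (sumFin-cong {k} λ t → cong (λ y → g y - g (suc y)) (ℕP.+-suc x (toℕ t))) ⟩
  g x - g (suc x) + sumFin {k} (λ t → g (suc x ℕ.+ toℕ t) - g (suc (suc x ℕ.+ toℕ t)))
    ≡⟨ cong (_+_ (g x - g (suc x))) (sumFin-telescope k g (suc x)) ⟩
  g x - g (suc x) + (g (suc x) - g (suc x ℕ.+ k))
    ≡⟨ collapse (g x) (g (suc x)) (g (suc x ℕ.+ k)) ⟩
  g x - g (suc x ℕ.+ k)
    ≡⟨ cong (λ y → g x - g y) (sym (ℕP.+-suc x k)) ⟩
  g x - g (x ℕ.+ suc k) ∎
  where
  open ≡-Reasoning
  collapse : ∀ p q r → p - q + (q - r) ≡ p - r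
  collapse = solve-∀

sumFin-swap : (F : Fin n → Fin k → ℤ) → sumFin (λ i → sumFin (F i)) ≡ sumFin (λ j → sumFin (λ i → F i j))
sumFin-swap {zero}  {k} F = sym (sumFin-zero {k} _ λ j → refl)
sumFin-swap {suc n} {k} F =
  trans (cong (_+_ (sumFin (F fzero))) (sumFin-swap (F ∘ fsuc)))
        (sym (sumFin-distrib-+ (F fzero) (λ j → sumFin (λ i → F (fsuc i) j))))

sumFin-const-1 : ∀ k → sumFin {k} (λ _ → + 1) ≡ + k
sumFin-const-1 zero    = refl
sumFin-const-1 (suc k) = cong (_+_ (+ 1)) (sumFin-const-1 k)

sumFin-δ : ∀ (c : Fin n) → sumFin {n} (λ r → δ (toℕ r) (toℕ c)) ≡ + 1
sumFin-δ {n} c =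
  trans (sumFin-single {n} (λ r → δ (toℕ r) (toℕ c)) c λ r r≢c → δ-≢ (r≢c ∘ FinP.toℕ-injective)) (δ-refl (toℕ c))

sumFin-select : ∀ (f : ℕ → ℤ) x → x ℕ.< n → sumFin {n} (λ j → f (toℕ j) * δ x (toℕ j)) ≡ f x
sumFin-select {n} f x x<n = begin
  sumFin {n} (λ j → f (toℕ j) * δ x (toℕ j))  ≡⟨ sumFin-single (λ j → f (toℕ j) * δ x (toℕ j)) j₀ others ⟩
  f (toℕ j₀) * δ x (toℕ j₀)                  ≡⟨ cong (λ y → f y * δ x y) j₀≡x ⟩
  f x * δ x x                                ≡⟨ cong (f x *_) (δ-refl x) ⟩
  f x * + 1                                  ≡⟨ ℤP.*-identityʳ (f x) ⟩
  f x                                        ∎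
  where
  open ≡-Reasoning
  j₀ : Fin n
  j₀ = fromℕ< x<n
  j₀≡x : toℕ j₀ ≡ x
  j₀≡x = FinP.toℕ-fromℕ< x<n
  others : ∀ j → j ≢ j₀ → f (toℕ j) * δ x (toℕ j) ≡ + 0
  others j j≢j₀ = trans (cong (f (toℕ j) *_) (δ-≢ λ x≡j → j≢j₀ (FinP.toℕ-injective (trans (sym x≡j) (sym j₀≡x)))))
                        (ℤP.*-zeroʳ (f (toℕ j)))

-- Determinants and column operations

column : Matrix n → Fin n → Fin n → ℤ
column M j i = M i j

replaceColumn : Matrix n → Fin n → (Fin n → ℤ) → Matrix n
replaceColumn M c v i j with j Fin.≟ c
... | yes _ = v i
... | no _  = M i j

replaceColumn-≡ : ∀ (M : Matrix n) c v i → replaceColumn M c v i c ≡ v i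
replaceColumn-≡ M c v i with c Fin.≟ c
... | yes _   = refl
... | no c≢c = ⊥-elim (c≢c refl)

replaceColumn-≢ : ∀ (M : Matrix n) c v i j → j ≢ c → replaceColumn M c v i j ≡ M i j
replaceColumn-≢ M c v i j j≢c with j Fin.≟ c
... | yes j≡c = ⊥-elim (j≢c j≡c)
... | no _    = refl

replaceColumn-column : ∀ (M : Matrix n) c i j → replaceColumn M c (column M c) i j ≡ M i j
replaceColumn-column M c i j with j Fin.≟ c
... | yes refl = refl
... | no _     = refl

AgreeOff : Fin n → Matrix n → Matrix n → Set
AgreeOff c A B = ∀ i j → j ≢ c → A i j ≡ B i j

det-cong : ∀ n {A B : Matrix n} → (∀ i j → A i j ≡ B i j) → det n A ≡ det n B
det-cong zero    A≗B = refl
det-cong (suc n) A≗B = sumFin-cong λ j →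
  cong₂ (λ x y → (- + 1) ℤ.^ toℕ j * (x * y)) (A≗B fzero j) (det-cong n (λ r c → A≗B (fsuc r) (punchIn j c)))

det-linear : ∀ n (A B C : Matrix n) c a → AgreeOff c A C → AgreeOff c B C →
             (∀ i → C i c ≡ a * A i c + B i c) → det n C ≡ a * det n A + det n B
det-linear (suc n) A B C c a A≈C B≈C Cc = begin
  sumFin (term C)                                 ≡⟨ sumFin-cong term-linear ⟩
  sumFin (λ j → a * term A j + term B j)          ≡⟨ sumFin-distrib-+ (λ j → a * term A j) (term B) ⟩
  sumFin (λ j → a * term A j) + det (suc n) B     ≡⟨ cong (_+ det (suc n) B) (sumFin-*ˡ a (term A)) ⟩
  a * det (suc n) A + det (suc n) B               ∎
  where
  open ≡-Reasoning
  term : Matrix (suc n) → Fin (suc n) → ℤ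
  term X j = (- + 1) ℤ.^ toℕ j * (X fzero j * det n (minor X j))

  minor-≈ : ∀ {X} → AgreeOff c X C → ∀ r k → minor X c r k ≡ minor C c r k
  minor-≈ X≈C r k = X≈C (fsuc r) (punchIn c k) (FinP.punchInᵢ≢i c k)

  term-linear : ∀ j → term C j ≡ a * term A j + term B j
  term-linear j with j Fin.≟ c
  ... | yes refl = begin
    s * (C fzero j * D)                         ≡⟨ cong (λ x → s * (x * D)) (Cc fzero) ⟩
    s * ((a * A fzero j + B fzero j) * D)       ≡⟨ distrib s a (A fzero j) (B fzero j) D ⟩
    a * (s * (A fzero j * D)) + s * (B fzero j * D)
      ≡⟨ cong₂ (λ P Q → a * (s * (A fzero j * P)) + s * (B fzero j * Q))
               (sym (det-cong n (minor-≈ A≈C))) (sym (det-cong n (minor-≈ B≈C))) ⟩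
    a * term A j + term B j                     ∎
    where
    s : ℤ
    s = (- + 1) ℤ.^ toℕ j
    D : ℤ
    D = det n (minor C j)
    distrib : ∀ s a x y D → s * ((a * x + y) * D) ≡ a * (s * (x * D)) + s * (y * D)
    distrib = solve-∀
  ... | no j≢c = begin
    s * (C fzero j * det n (minor C j))
      ≡⟨ cong (λ P → s * (C fzero j * P)) (det-linear n (minor A j) (minor B j) (minor C j) c′ a
                                              (minor-≈′ A≈C) (minor-≈′ B≈C) minorCc′) ⟩
    s * (C fzero j * (a * det n (minor A j) + det n (minor B j)))
      ≡⟨ distrib s a (C fzero j) _ _ ⟩
    a * (s * (C fzero j * det n (minor A j))) + s * (C fzero j * det n (minor B j))
      ≡⟨ cong₂ (λ x y → a * (s * (x * det n (minor A j))) + s * (y * det n (minor B j)))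
               (sym (A≈C fzero j j≢c)) (sym (B≈C fzero j j≢c)) ⟩
    a * term A j + term B j ∎
    where
    s : ℤ
    s = (- + 1) ℤ.^ toℕ j
    c′ : Fin n
    c′ = punchOut j≢c
    punchIn-c′ : punchIn j c′ ≡ c
    punchIn-c′ = FinP.punchIn-punchOut j≢c
    minor-≈′ : ∀ {X} → AgreeOff c X C → AgreeOff c′ (minor X j) (minor C j)
    minor-≈′ X≈C r k k≢c′ = X≈C (fsuc r) (punchIn j k)
      (λ eq → k≢c′ (FinP.punchIn-injective j k c′ (trans eq (sym punchIn-c′))))
    minorCc′ : ∀ r → minor C j r c′ ≡ a * minor A j r c′ + minor B j r c′
    minorCc′ r rewrite punchIn-c′ = Cc (fsuc r)
    distrib : ∀ s a x P Q → s * (x * (a * P + Q)) ≡ a * (s * (x * P)) + s * (x * Q)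
    distrib = solve-∀

det-additive : ∀ n (A B C : Matrix n) c → AgreeOff c A C → AgreeOff c B C →
               (∀ i → C i c ≡ A i c + B i c) → det n C ≡ det n A + det n B
det-additive n A B C c A≈C B≈C Cc =
  trans (det-linear n A B C c (+ 1) A≈C B≈C (λ i → trans (Cc i) (cong (_+ B i c) (sym (ℤP.*-identityˡ (A i c))))))
        (cong (_+ det n B) (ℤP.*-identityˡ (det n A)))

det-zeroColumn : ∀ n (M : Matrix n) c → (∀ i → M i c ≡ + 0) → det n M ≡ + 0
det-zeroColumn n M c Mc≡0 = identityʳ-unique (det n M) (det n M) (sym (det-additive n M M M c (λ _ _ _ → refl) (λ _ _ _ → refl)
  λ i → trans (Mc≡0 i) (sym (cong₂ _+_ (Mc≡0 i) (Mc≡0 i)))))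

-- Adjacent columns of a matrix of size suc n are encoded as inject₁ a and fsuc a.

punchIn-adjacent : ∀ (a k : Fin n) →
  punchIn (inject₁ a) k ≡ punchIn (fsuc a) k ⊎ (punchIn (inject₁ a) k ≡ fsuc a × punchIn (fsuc a) k ≡ inject₁ a)
punchIn-adjacent fzero    fzero    = inj₂ (refl , refl)
punchIn-adjacent fzero    (fsuc k) = inj₁ refl
punchIn-adjacent (fsuc a) fzero    = inj₁ refl
punchIn-adjacent (fsuc a) (fsuc k) with punchIn-adjacent a k
... | inj₁ eq         = inj₁ (cong fsuc eq)
... | inj₂ (eq , eq′) = inj₂ (cong fsuc eq , cong fsuc eq′)

punchOut-adjacent : ∀ (j : Fin (suc (suc n))) (a : Fin (suc n)) → j ≢ inject₁ a → j ≢ fsuc a →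
  ∃[ a′ ] punchIn j (inject₁ a′) ≡ inject₁ a × punchIn j (fsuc a′) ≡ fsuc a
punchOut-adjacent         fzero           fzero    j≢a j≢b = ⊥-elim (j≢a refl)
punchOut-adjacent         fzero           (fsuc a) j≢a j≢b = a , refl , refl
punchOut-adjacent         (fsuc fzero)    fzero    j≢a j≢b = ⊥-elim (j≢b refl)
punchOut-adjacent {suc n} (fsuc (fsuc j)) fzero    j≢a j≢b = fzero , refl , refl
punchOut-adjacent {suc n} (fsuc j)        (fsuc a) j≢a j≢b
  with a′ , eq , eq′ ← punchOut-adjacent j a (j≢a ∘ cong fsuc) (j≢b ∘ cong fsuc)
  = fsuc a′ , cong fsuc eq , cong fsuc eq′

det-adjacentEqualColumns : ∀ n (M : Matrix (suc n)) (a : Fin n) →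
  (∀ i → M i (inject₁ a) ≡ M i (fsuc a)) → det (suc n) M ≡ + 0
det-adjacentEqualColumns (suc n) M a Ma≡Mb = begin
  sumFin term                              ≡⟨ sumFin-pair term (inject₁ a) (fsuc a) inject₁≢fsuc others-vanish ⟩
  term (inject₁ a) + term (fsuc a)
    ≡⟨ cong₂ (λ s′ y → s′ * (x * D) + (- + 1) * s * y)
             (cong ((- + 1) ℤ.^_) (FinP.toℕ-inject₁ a)) (cong₂ _*_ (sym (Ma≡Mb fzero)) (sym same-minors)) ⟩
  s * (x * D) + (- + 1) * s * (x * D)      ≡⟨ opposite-signs s (x * D) ⟩
  + 0                                      ∎
  where
  open ≡-Reasoning
  term : Fin (suc (suc n)) → ℤ
  term j = (- + 1) ℤ.^ toℕ j * (M fzero j * det (suc n) (minor M j))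
  s : ℤ
  s = (- + 1) ℤ.^ toℕ a
  x : ℤ
  x = M fzero (inject₁ a)
  D : ℤ
  D = det (suc n) (minor M (inject₁ a))
  opposite-signs : ∀ s y → s * y + (- + 1) * s * y ≡ + 0
  opposite-signs = solve-∀

  inject₁≢fsuc : inject₁ a ≢ fsuc a
  inject₁≢fsuc eq = ℕP.1+n≢n (sym (trans (sym (FinP.toℕ-inject₁ a)) (cong toℕ eq)))

  others-vanish : ∀ j → j ≢ inject₁ a → j ≢ fsuc a → term j ≡ + 0
  others-vanish j j≢a j≢b
    with a′ , eq , eq′ ← punchOut-adjacent j a j≢a j≢b
    = trans (cong (λ D → (- + 1) ℤ.^ toℕ j * (M fzero j * D))
                  (det-adjacentEqualColumns n (minor M j) a′
                     λ r → trans (cong (M (fsuc r)) eq) (trans (Ma≡Mb (fsuc r)) (cong (M (fsuc r)) (sym eq′)))))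
            (trans (cong ((- + 1) ℤ.^ toℕ j *_) (ℤP.*-zeroʳ (M fzero j))) (ℤP.*-zeroʳ ((- + 1) ℤ.^ toℕ j)))

  same-minors : det (suc n) (minor M (inject₁ a)) ≡ det (suc n) (minor M (fsuc a))
  same-minors = det-cong (suc n) minor-entries
    where
    minor-entries : ∀ r k → minor M (inject₁ a) r k ≡ minor M (fsuc a) r k
    minor-entries r k with punchIn-adjacent a k
    ... | inj₁ eq         = cong (M (fsuc r)) eq
    ... | inj₂ (eq , eq′) =
      trans (cong (M (fsuc r)) eq) (trans (sym (Ma≡Mb (fsuc r))) (cong (M (fsuc r)) (sym eq′)))

swapColumns : Matrix n → Fin n → Fin n → Matrix n
swapColumns A p q = replaceColumn (replaceColumn A p (column A q)) q (column A p)

det-swapAdjacentColumns : ∀ n (A : Matrix (suc n)) (a : Fin n) →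
  det (suc n) (swapColumns A (inject₁ a) (fsuc a)) ≡ - det (suc n) A
det-swapAdjacentColumns n A a = inverseʳ-unique (det (suc n) A) (f y x) (begin
  det (suc n) A + f y x                    ≡⟨ pad (det (suc n) A) (f y x) ⟩
  + 0 + det (suc n) A + (f y x + + 0)      ≡⟨ cong₂ (λ P Q → P + det (suc n) A + (f y x + Q)) (sym (alternating x)) (sym (alternating y)) ⟩
  f x x + det (suc n) A + (f y x + f y y)  ≡⟨ cong (λ D → f x x + D + (f y x + f y y)) (sym f-columns) ⟩
  f x x + f x y + (f y x + f y y)          ≡⟨ sym (cong₂ _+_ (additiveʳ x x y) (additiveʳ y x y)) ⟩
  f x s + f y s                            ≡⟨ sym (additiveˡ x y s) ⟩
  f s s                                    ≡⟨ alternating s ⟩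
  + 0                                      ∎)
  where
  open ≡-Reasoning
  pad : ∀ a b → a + b ≡ + 0 + a + (b + + 0)
  pad = solve-∀
  p : Fin (suc n)
  p = inject₁ a
  q : Fin (suc n)
  q = fsuc a
  p≢q : p ≢ q
  p≢q eq = ℕP.1+n≢n (sym (trans (sym (FinP.toℕ-inject₁ a)) (cong toℕ eq)))

  G : (Fin (suc n) → ℤ) → (Fin (suc n) → ℤ) → Matrix (suc n)
  G u v = replaceColumn (replaceColumn A p u) q v
  f : (Fin (suc n) → ℤ) → (Fin (suc n) → ℤ) → ℤ
  f u v = det (suc n) (G u v)
  x : Fin (suc n) → ℤ
  x = column A p
  y : Fin (suc n) → ℤ
  y = column A q
  s : Fin (suc n) → ℤ
  s i = x i + y i

  G-p : ∀ u v i → G u v i p ≡ u i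
  G-p u v i = trans (replaceColumn-≢ _ q v i p p≢q) (replaceColumn-≡ A p u i)
  G-q : ∀ u v i → G u v i q ≡ v i
  G-q u v i = replaceColumn-≡ _ q v i
  G-other : ∀ u v u′ v′ i j → j ≢ p → j ≢ q → G u v i j ≡ G u′ v′ i j
  G-other u v u′ v′ i j j≢p j≢q =
    trans (replaceColumn-≢ _ q v i j j≢q)
          (trans (replaceColumn-≢ A p u i j j≢p)
                 (sym (trans (replaceColumn-≢ _ q v′ i j j≢q) (replaceColumn-≢ A p u′ i j j≢p))))

  additiveʳ : ∀ u v w → f u (λ i → v i + w i) ≡ f u v + f u w
  additiveʳ u v w = det-additive (suc n) (G u v) (G u w) (G u (λ i → v i + w i)) q
    (λ i j j≢q → trans (replaceColumn-≢ _ q v i j j≢q) (sym (replaceColumn-≢ _ q _ i j j≢q)))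
    (λ i j j≢q → trans (replaceColumn-≢ _ q w i j j≢q) (sym (replaceColumn-≢ _ q _ i j j≢q)))
    (λ i → trans (G-q u _ i) (sym (cong₂ _+_ (G-q u v i) (G-q u w i))))

  G-off-p : ∀ u u′ v i j → j ≢ p → G u v i j ≡ G u′ v i j
  G-off-p u u′ v i j j≢p = by-cases (j Fin.≟ q)
    where
    by-cases : Dec (j ≡ q) → G u v i j ≡ G u′ v i j
    by-cases (yes refl) = trans (G-q u v i) (sym (G-q u′ v i))
    by-cases (no j≢q)   = G-other u v u′ v i j j≢p j≢q

  additiveˡ : ∀ u w v → f (λ i → u i + w i) v ≡ f u v + f w v
  additiveˡ u w v = det-additive (suc n) (G u v) (G w v) (G (λ i → u i + w i) v) p
    (λ i j j≢p → G-off-p u _ v i j j≢p) (λ i j j≢p → G-off-p w _ v i j j≢p)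
    (λ i → trans (G-p _ v i) (sym (cong₂ _+_ (G-p u v i) (G-p w v i))))

  alternating : ∀ u → f u u ≡ + 0
  alternating u = det-adjacentEqualColumns n (G u u) a λ i → trans (G-p u u i) (sym (G-q u u i))

  f-columns : f x y ≡ det (suc n) A
  f-columns = det-cong (suc n) entries
    where
    entries : ∀ i j → G x y i j ≡ A i j
    entries i j = by-cases (j Fin.≟ p) (j Fin.≟ q)
      where
      by-cases : Dec (j ≡ p) → Dec (j ≡ q) → G x y i j ≡ A i j
      by-cases (yes refl) _          = G-p x y i
      by-cases (no _)     (yes refl) = G-q x y i
      by-cases (no j≢p)   (no j≢q)   = trans (replaceColumn-≢ _ q y i j j≢q) (replaceColumn-≢ A p x i j j≢p)

-- An adjacent swap (negating det) moves the column fsuc c one step closer to c₁.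
det-equalColumns-gap : ∀ k n (M : Matrix (suc n)) c₁ (c : Fin n) → toℕ c ≡ toℕ c₁ ℕ.+ k →
  (∀ i → M i c₁ ≡ M i (fsuc c)) → det (suc n) M ≡ + 0
det-equalColumns-gap zero n M c₁ c c≡c₁ Mc₁≡Mc = det-adjacentEqualColumns n M c λ i →
  trans (cong (M i) (FinP.toℕ-injective (trans (FinP.toℕ-inject₁ c) (trans c≡c₁ (ℕP.+-identityʳ _)))))
        (Mc₁≡Mc i)
det-equalColumns-gap (suc k) n M c₁ fzero 0≡ _ = ⊥-elim (ℕP.m+1+n≢0 (toℕ c₁) (sym 0≡))
det-equalColumns-gap (suc k) n M c₁ (fsuc c) c≡c₁+k Mc₁≡Mc = begin
  det (suc n) M          ≡⟨ sym (ℤP.neg-involutive _) ⟩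
  - - det (suc n) M      ≡⟨ cong -_ (sym (det-swapAdjacentColumns n M (fsuc c))) ⟩
  - det (suc n) M′       ≡⟨ cong -_ (det-equalColumns-gap k n M′ c₁ (inject₁ c) gap M′c₁≡M′c) ⟩
  + 0                    ∎
  where
  open ≡-Reasoning
  M′ : Matrix (suc n)
  M′ = swapColumns M (inject₁ (fsuc c)) (fsuc (fsuc c))
  gap : toℕ (inject₁ c) ≡ toℕ c₁ ℕ.+ k
  gap = trans (FinP.toℕ-inject₁ c) (ℕP.suc-injective (trans c≡c₁+k (ℕP.+-suc (toℕ c₁) k)))
  p : Fin (suc n)
  p = inject₁ (fsuc c)
  q : Fin (suc n)
  q = fsuc (fsuc c)
  c₁<c : toℕ c₁ ℕ.< toℕ (fsuc c)
  c₁<c = subst (toℕ c₁ ℕ.<_) (sym c≡c₁+k) (ℕP.m<m+n (toℕ c₁) ℕ.z<s)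
  c₁≢p : c₁ ≢ p
  c₁≢p eq = ℕP.<-irrefl (trans (cong toℕ eq) (FinP.toℕ-inject₁ (fsuc c))) c₁<c
  c₁≢q : c₁ ≢ q
  c₁≢q eq = ℕP.<-irrefl (cong toℕ eq) (ℕP.<-trans c₁<c (ℕP.n<1+n (toℕ (fsuc c))))
  p≢q : p ≢ q
  p≢q eq = ℕP.1+n≢n (sym (trans (sym (FinP.toℕ-inject₁ (fsuc c))) (cong toℕ eq)))
  M′c₁≡M′c : ∀ i → M′ i c₁ ≡ M′ i (fsuc (inject₁ c))
  M′c₁≡M′c i =
    trans (replaceColumn-≢ _ q _ i c₁ c₁≢q)
          (trans (replaceColumn-≢ M p _ i c₁ c₁≢p)
                 (trans (Mc₁≡Mc i)
                        (sym (trans (replaceColumn-≢ _ q _ i p p≢q) (replaceColumn-≡ M p _ i)))))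

det-equalColumns-< : ∀ n (M : Matrix n) c₁ c₂ → toℕ c₁ ℕ.< toℕ c₂ → (∀ i → M i c₁ ≡ M i c₂) → det n M ≡ + 0
det-equalColumns-< (suc n) M c₁ (fsuc c) (ℕ.s≤s c₁≤c) =
  det-equalColumns-gap (toℕ c ℕ.∸ toℕ c₁) n M c₁ c (sym (ℕP.m+[n∸m]≡n c₁≤c))

det-equalColumns : ∀ n (M : Matrix n) c₁ c₂ → c₁ ≢ c₂ → (∀ i → M i c₁ ≡ M i c₂) → det n M ≡ + 0
det-equalColumns n M c₁ c₂ c₁≢c₂ Mc₁≡Mc₂ with ℕP.<-cmp (toℕ c₁) (toℕ c₂)
... | tri< c₁<c₂ _ _ = det-equalColumns-< n M c₁ c₂ c₁<c₂ Mc₁≡Mc₂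
... | tri≈ _ c₁≡c₂ _ = ⊥-elim (c₁≢c₂ (FinP.toℕ-injective c₁≡c₂))
... | tri> _ _ c₂<c₁ = det-equalColumns-< n M c₂ c₁ c₂<c₁ (sym ∘ Mc₁≡Mc₂)

det-replaceColumn-combination : ∀ n (M : Matrix n) c (κ : Fin n → ℤ) →
  det n (replaceColumn M c (λ i → sumFin (λ l → κ l * M i l))) ≡ κ c * det n M
det-replaceColumn-combination n M c κ = begin
  F (λ i → sumFin (λ l → κ l * M i l))     ≡⟨ F-combination n κ (column M) ⟩
  sumFin (λ l → κ l * F (column M l))
    ≡⟨ sumFin-single _ c (λ l l≢c → trans (cong (κ l *_) (F-otherColumn l l≢c)) (ℤP.*-zeroʳ (κ l))) ⟩
  κ c * F (column M c)                     ≡⟨ cong (κ c *_) (det-cong n (replaceColumn-column M c)) ⟩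
  κ c * det n M                            ∎
  where
  open ≡-Reasoning
  F : (Fin n → ℤ) → ℤ
  F v = det n (replaceColumn M c v)

  agree : ∀ u v → AgreeOff c (replaceColumn M c u) (replaceColumn M c v)
  agree u v i j j≢c = trans (replaceColumn-≢ M c u i j j≢c) (sym (replaceColumn-≢ M c v i j j≢c))

  F-zero : F (λ _ → + 0) ≡ + 0
  F-zero = det-zeroColumn n _ c (replaceColumn-≡ M c _)

  F-linear : ∀ a u v → F (λ i → a * u i + v i) ≡ a * F u + F v
  F-linear a u v = det-linear n _ _ _ c a (agree u _) (agree v _)
    (λ i → trans (replaceColumn-≡ M c _ i) (sym (cong₂ (λ x y → a * x + y) (replaceColumn-≡ M c u i) (replaceColumn-≡ M c v i))))

  F-combination : ∀ k (coeff : Fin k → ℤ) (g : Fin k → Fin n → ℤ) →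
    F (λ i → sumFin (λ t → coeff t * g t i)) ≡ sumFin (λ t → coeff t * F (g t))
  F-combination zero    coeff g = F-zero
  F-combination (suc k) coeff g =
    trans (F-linear (coeff fzero) (g fzero) _) (cong (_+_ (coeff fzero * F (g fzero))) (F-combination k (coeff ∘ fsuc) (g ∘ fsuc)))

  F-otherColumn : ∀ l → l ≢ c → F (column M l) ≡ + 0
  F-otherColumn l l≢c = det-equalColumns n _ c l (l≢c ∘ sym)
    λ i → trans (replaceColumn-≡ M c _ i) (sym (replaceColumn-≢ M c _ i l l≢c))

det-dependentColumns : ∀ n (M : Matrix n) (κ : Fin n → ℤ) c → κ c ≢ + 0 →
  (∀ i → sumFin (λ l → κ l * M i l) ≡ + 0) → det n M ≡ + 0
det-dependentColumns n M κ c κc≢0 combination≡0 with ℤP.i*j≡0⇒i≡0∨j≡0 (κ c) κc*det≡0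
  where
  κc*det≡0 : κ c * det n M ≡ + 0
  κc*det≡0 = trans (sym (det-replaceColumn-combination n M c κ))
                   (det-zeroColumn n _ c λ i → trans (replaceColumn-≡ M c _ i) (combination≡0 i))
... | inj₁ κc≡0  = ⊥-elim (κc≢0 κc≡0)
... | inj₂ det≡0 = det≡0

det-addColumn : ∀ n (M N : Matrix n) c e a → c ≢ e → AgreeOff c N M →
  (∀ i → N i c ≡ M i c + a * M i e) → det n N ≡ det n M
det-addColumn n M N c e a c≢e N≈M Nc = begin
  det n N                   ≡⟨ det-linear n M′ M N c a M′≈N (λ i j j≢c → sym (N≈M i j j≢c)) N-c ⟩
  a * det n M′ + det n M    ≡⟨ cong (λ D → a * D + det n M) M′-singular ⟩
  a * + 0 + det n M         ≡⟨ cong (_+ det n M) (ℤP.*-zeroʳ a) ⟩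
  + 0 + det n M             ≡⟨ ℤP.+-identityˡ (det n M) ⟩
  det n M                   ∎
  where
  open ≡-Reasoning
  M′ : Matrix n
  M′ = replaceColumn M c (column M e)
  M′≈N : AgreeOff c M′ N
  M′≈N i j j≢c = trans (replaceColumn-≢ M c _ i j j≢c) (sym (N≈M i j j≢c))
  N-c : ∀ i → N i c ≡ a * M′ i c + M i c
  N-c i = trans (Nc i) (trans (ℤP.+-comm (M i c) (a * M i e)) (cong (λ x → a * x + M i c) (sym (replaceColumn-≡ M c _ i))))
  M′-singular : det n M′ ≡ + 0
  M′-singular = det-equalColumns n M′ c e c≢e
    λ i → trans (replaceColumn-≡ M c _ i) (sym (replaceColumn-≢ M c _ i e (c≢e ∘ sym)))

-- Columns are treated downwards: `partial t` has received the multiples in the columns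
-- j with t ≤ j, so the source column σ j < j is still untouched when j is treated.
module ColumnMultiples {n} (M : Matrix n) (σ : Fin n → Fin n) (κ : Fin n → ℤ)
                       (triangular : ∀ j → toℕ j ℕ.≤ toℕ (σ j) → κ j ≡ + 0) where
  coeffFrom : ℕ → Fin n → ℤ
  coeffFrom t j with t ℕ.≤? toℕ j
  ... | yes _ = κ j
  ... | no _  = + 0

  coeffFrom-≤ : ∀ t j → t ℕ.≤ toℕ j → coeffFrom t j ≡ κ j
  coeffFrom-≤ t j t≤j with t ℕ.≤? toℕ j
  ... | yes _  = refl
  ... | no t≰j = ⊥-elim (t≰j t≤j)

  coeffFrom-> : ∀ t j → toℕ j ℕ.< t → coeffFrom t j ≡ + 0
  coeffFrom-> t j j<t with t ℕ.≤? toℕ j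
  ... | yes t≤j = ⊥-elim (ℕP.<-irrefl refl (ℕP.<-≤-trans j<t t≤j))
  ... | no _    = refl

  coeffFrom-suc : ∀ t j → toℕ j ≢ t → coeffFrom (suc t) j ≡ coeffFrom t j
  coeffFrom-suc t j j≢t with suc t ℕ.≤? toℕ j | t ℕ.≤? toℕ j
  ... | yes _     | yes _   = refl
  ... | no _      | no _    = refl
  ... | yes 1+t≤j | no t≰j  = ⊥-elim (t≰j (ℕP.<⇒≤ 1+t≤j))
  ... | no 1+t≰j  | yes t≤j = ⊥-elim (1+t≰j (ℕP.≤∧≢⇒< t≤j (j≢t ∘ sym)))

  partial : ℕ → Matrix n
  partial t i j = M i j + coeffFrom t j * M i (σ j)

  partial-untouched : ∀ t i j → toℕ j ℕ.< t → partial t i j ≡ M i j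
  partial-untouched t i j j<t = trans (cong (λ x → M i j + x * M i (σ j)) (coeffFrom-> t j j<t))
                                      (trans (cong (_+_ (M i j)) (ℤP.*-zeroˡ (M i (σ j)))) (ℤP.+-identityʳ (M i j)))

  partial-agree : ∀ t j₀ → toℕ j₀ ≡ t → AgreeOff j₀ (partial t) (partial (suc t))
  partial-agree t j₀ j₀≡t i j j≢j₀ = cong (λ x → M i j + x * M i (σ j))
    (sym (coeffFrom-suc t j λ j≡t → j≢j₀ (FinP.toℕ-injective (trans j≡t (sym j₀≡t)))))

  det-partial-step : ∀ t j₀ → toℕ j₀ ≡ t → det n (partial t) ≡ det n (partial (suc t))
  det-partial-step t j₀ j₀≡t with toℕ j₀ ℕ.≤? toℕ (σ j₀)
  ... | yes j₀≤σj₀ = det-cong n λ i j → by-cases i j (j Fin.≟ j₀)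
    where
    by-cases : ∀ i j → Dec (j ≡ j₀) → partial t i j ≡ partial (suc t) i j
    by-cases i j (no j≢j₀)  = partial-agree t j₀ j₀≡t i j j≢j₀
    by-cases i j (yes refl) = cong (λ x → M i j + x * M i (σ j)) (begin
      coeffFrom t j         ≡⟨ coeffFrom-≤ t j (ℕP.≤-reflexive (sym j₀≡t)) ⟩
      κ j                   ≡⟨ triangular j j₀≤σj₀ ⟩
      + 0                   ≡⟨ coeffFrom-> (suc t) j (ℕ.s≤s (ℕP.≤-reflexive j₀≡t)) ⟨
      coeffFrom (suc t) j   ∎)
      where open ≡-Reasoning
  ... | no j₀≰σj₀ =
    det-addColumn n (partial (suc t)) (partial t) j₀ (σ j₀) (κ j₀) j₀≢σj₀ (partial-agree t j₀ j₀≡t) λ i → begin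
      M i j₀ + coeffFrom t j₀ * M i (σ j₀)
        ≡⟨ cong (λ x → M i j₀ + x * M i (σ j₀)) (coeffFrom-≤ t j₀ (ℕP.≤-reflexive (sym j₀≡t))) ⟩
      M i j₀ + κ j₀ * M i (σ j₀)
        ≡⟨ cong₂ (λ x y → x + κ j₀ * y) (partial-untouched (suc t) i j₀ (ℕ.s≤s (ℕP.≤-reflexive j₀≡t)))
                                        (partial-untouched (suc t) i (σ j₀) σj₀<1+t) ⟨
      partial (suc t) i j₀ + κ j₀ * partial (suc t) i (σ j₀) ∎
    where
    open ≡-Reasoning
    σj₀<j₀ : toℕ (σ j₀) ℕ.< toℕ j₀
    σj₀<j₀ = ℕP.≰⇒> j₀≰σj₀
    j₀≢σj₀ : j₀ ≢ σ j₀
    j₀≢σj₀ eq = ℕP.<-irrefl (cong toℕ (sym eq)) σj₀<j₀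
    σj₀<1+t : toℕ (σ j₀) ℕ.< suc t
    σj₀<1+t = ℕP.<-trans σj₀<j₀ (ℕ.s≤s (ℕP.≤-reflexive j₀≡t))

  det-partial : ∀ s t → s ℕ.+ t ≡ n → det n (partial t) ≡ det n M
  det-partial zero    t t≡n = det-cong n λ i j → partial-untouched t i j (subst (toℕ j ℕ.<_) (sym t≡n) (FinP.toℕ<n j))
  det-partial (suc s) t s+t≡n =
    trans (det-partial-step t (fromℕ< t<n) (FinP.toℕ-fromℕ< t<n)) (det-partial s (suc t) (trans (ℕP.+-suc s t) s+t≡n))
    where
    t<n : t ℕ.< n
    t<n = subst (t ℕ.<_) s+t≡n (ℕP.m<n+m t ℕ.z<s)

det-addColumnMultiples : ∀ n (M : Matrix n) (σ : Fin n → Fin n) (κ : Fin n → ℤ) →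
  (∀ j → toℕ j ℕ.≤ toℕ (σ j) → κ j ≡ + 0) → det n (λ i j → M i j + κ j * M i (σ j)) ≡ det n M
det-addColumnMultiples n M σ κ triangular =
  trans (det-cong n λ i j → cong (λ x → M i j + x * M i (σ j)) (sym (coeffFrom-≤ 0 j ℕ.z≤n)))
        (det-partial n 0 (ℕP.+-identityʳ n))
  where open ColumnMultiples M σ κ triangular

det-firstRowUnit : ∀ n (M : Matrix (suc n)) → M fzero fzero ≡ + 1 → (∀ c → M fzero (fsuc c) ≡ + 0) →
  det (suc n) M ≡ det n (minor M fzero)
det-firstRowUnit n M M₀₀≡1 M₀ⱼ≡0 = begin
  + 1 * (M fzero fzero * D) + rest   ≡⟨ cong₂ (λ x y → + 1 * (x * D) + y) M₀₀≡1 rest≡0 ⟩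
  + 1 * (+ 1 * D) + + 0              ≡⟨ unit (det n (minor M fzero)) ⟩
  D                                  ∎
  where
  open ≡-Reasoning
  D : ℤ
  D = det n (minor M fzero)
  rest : ℤ
  rest = sumFin (λ j → (- + 1) ℤ.^ toℕ (fsuc j) * (M fzero (fsuc j) * det n (minor M (fsuc j))))
  rest≡0 : rest ≡ + 0
  rest≡0 = sumFin-zero _ λ j → trans (cong (λ x → (- + 1) ℤ.^ toℕ (fsuc j) * (x * det n (minor M (fsuc j)))) (M₀ⱼ≡0 j))
                                     (ℤP.*-zeroʳ ((- + 1) ℤ.^ toℕ (fsuc j)))
  unit : ∀ x → + 1 * (+ 1 * x) + + 0 ≡ x
  unit = solve-∀

-- Weighted incidence matrices of rooted trees

-- The height certifies that iterating parent from any vertex reaches the root fromℕ k.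
record RootedTree (k : ℕ) : Set where
  field
    parent        : Fin (suc k) → Fin (suc k)
    height        : Fin (suc k) → ℕ
    height-parent : ∀ v → v ≢ fromℕ k → height (parent v) ℕ.< height v

record IsWeightedIncidence (t : RootedTree k) (w : Fin (suc k) → ℤ) (T : Matrix (suc k)) : Set where
  open RootedTree t
  field
    root-column : ∀ i → T i (fromℕ k) ≡ w i
    edge-column : ∀ i v → v ≢ fromℕ k → T i v ≡ δ (toℕ i) (toℕ v) - δ (toℕ i) (toℕ (parent v))

-- Clearing row 0 (vertex 0 is not the root) by column operations contracts the edge from
-- vertex 0 to its parent: the children of 0 are reattached to the parent, and the weight of
-- vertex 0 moves to the parent.
module Contraction (t : RootedTree (suc k)) (w : Fin (suc (suc k)) → ℤ) (T : Matrix (suc (suc k)))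
                   (T-incidence : IsWeightedIncidence t w T)
                   (q₀ : Fin (suc k)) (parent₀ : RootedTree.parent t fzero ≡ fsuc q₀) where
  open RootedTree t
  open IsWeightedIncidence T-incidence

  root : Fin (suc (suc k))
  root = fromℕ (suc k)

  reattach : Fin (suc (suc k)) → Fin (suc k)
  reattach fzero    = q₀
  reattach (fsuc q) = q

  contracted : RootedTree k
  contracted = record
    { parent        = λ c → reattach (parent (fsuc c))
    ; height        = λ c → height (fsuc c)
    ; height-parent = height-reattach
    }
    where
    height-reattach : ∀ c → c ≢ fromℕ k → height (fsuc (reattach (parent (fsuc c)))) ℕ.< height (fsuc c)
    height-reattach c c≢root with parent (fsuc c) in eq
    ... | fzero  = ℕP.<-trans (subst (λ p → height p ℕ.< height fzero) parent₀ (height-parent fzero λ ()))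
                              (subst (λ p → height p ℕ.< height (fsuc c)) eq (height-parent (fsuc c) (c≢root ∘ FinP.suc-injective)))
    ... | fsuc q = subst (λ p → height p ℕ.< height (fsuc c)) eq (height-parent (fsuc c) (c≢root ∘ FinP.suc-injective))

  -- The multiple of column 0 added to column v, chosen to clear row 0.
  κ : Fin (suc (suc k)) → ℤ
  κ v with v Fin.≟ root
  ... | yes _ = - w fzero
  ... | no _  = δ 0 (toℕ (parent v))

  κ-root : κ root ≡ - w fzero
  κ-root with root Fin.≟ root
  ... | yes _        = refl
  ... | no root≢root = ⊥-elim (root≢root refl)

  κ-edge : ∀ v → v ≢ root → κ v ≡ δ 0 (toℕ (parent v))
  κ-edge v v≢root with v Fin.≟ root
  ... | yes v≡root = ⊥-elim (v≢root v≡root)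
  ... | no _       = refl

  T₀ : ∀ i → T i fzero ≡ δ (toℕ i) 0 - δ (toℕ i) (suc (toℕ q₀))
  T₀ i = trans (edge-column i fzero λ ()) (cong (λ p → δ (toℕ i) 0 - δ (toℕ i) (toℕ p)) parent₀)

  T′ : Matrix (suc (suc k))
  T′ i v = T i v + κ v * T i fzero

  κ-fzero : κ fzero ≡ + 0
  κ-fzero = trans (κ-edge fzero λ ()) (cong (δ 0 ∘ toℕ) parent₀)

  det-T′ : det (suc (suc k)) T′ ≡ det (suc (suc k)) T
  det-T′ = det-addColumnMultiples _ T (λ _ → fzero) κ κ₀≡0
    where
    κ₀≡0 : ∀ v → toℕ v ℕ.≤ 0 → κ v ≡ + 0
    κ₀≡0 fzero _ = κ-fzero

  T′₀₀ : T′ fzero fzero ≡ + 1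
  T′₀₀ = cong₂ (λ x y → x + y * x) (T₀ fzero) κ-fzero

  T′₀ⱼ : ∀ c → T′ fzero (fsuc c) ≡ + 0
  T′₀ⱼ c = by-cases (fsuc c Fin.≟ root)
    where
    cancel : ∀ x → x + - x * (+ 1 - + 0) ≡ + 0
    cancel = solve-∀
    cancel′ : ∀ x → + 0 - x + x * (+ 1 - + 0) ≡ + 0
    cancel′ = solve-∀
    by-cases : Dec (fsuc c ≡ root) → T′ fzero (fsuc c) ≡ + 0
    by-cases (yes refl) = trans (cong₂ (λ x y → x + y * T fzero fzero) (root-column fzero) κ-root)
                                (trans (cong (λ z → w fzero + - w fzero * z) (T₀ fzero)) (cancel (w fzero)))
    by-cases (no c≢root) = trans (cong₂ (λ x y → x + y * T fzero fzero)
                                        (edge-column fzero (fsuc c) c≢root) (κ-edge (fsuc c) c≢root))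
                                 (trans (cong (λ z → + 0 - p₀ + p₀ * z) (T₀ fzero)) (cancel′ p₀))
      where
      p₀ : ℤ
      p₀ = δ 0 (toℕ (parent (fsuc c)))

  δq₀ : Fin (suc k) → ℤ
  δq₀ r = δ (toℕ r) (toℕ q₀)

  T₀-below : ∀ r → T (fsuc r) fzero ≡ + 0 - δq₀ r
  T₀-below r = trans (T₀ (fsuc r)) (cong (λ x → + 0 - x) (δ-suc (toℕ r) (toℕ q₀)))

  w′ : Fin (suc k) → ℤ
  w′ r = w (fsuc r) + w fzero * δq₀ r

  edge-entry : ∀ (r c : Fin (suc k)) p →
    δ (suc (toℕ r)) (suc (toℕ c)) - δ (suc (toℕ r)) (toℕ p) + δ 0 (toℕ p) * (+ 0 - δq₀ r)
      ≡ δ (toℕ r) (toℕ c) - δ (toℕ r) (toℕ (reattach p))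
  edge-entry r c fzero    =
    trans (cong (λ x → x - + 0 + + 1 * (+ 0 - δq₀ r)) (δ-suc (toℕ r) (toℕ c))) (regroup (δ (toℕ r) (toℕ c)) (δq₀ r))
    where
    regroup : ∀ x y → x - + 0 + + 1 * (+ 0 - y) ≡ x - y
    regroup = solve-∀
  edge-entry r c (fsuc q) =
    trans (cong₂ (λ x y → x - y + + 0 * (+ 0 - δq₀ r)) (δ-suc (toℕ r) (toℕ c)) (δ-suc (toℕ r) (toℕ q)))
          (regroup (δ (toℕ r) (toℕ c)) (δ (toℕ r) (toℕ q)) (+ 0 - δq₀ r))
    where
    regroup : ∀ x y z → x - y + + 0 * z ≡ x - y
    regroup = solve-∀

  minor-incidence : IsWeightedIncidence contracted w′ (minor T′ fzero)
  minor-incidence = record { root-column = root-column′ ; edge-column = edge-column′ }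
    where
    open ≡-Reasoning
    regroup : ∀ a b x → a + - b * (+ 0 - x) ≡ a + b * x
    regroup = solve-∀

    root-column′ : ∀ r → T′ (fsuc r) (fsuc (fromℕ k)) ≡ w′ r
    root-column′ r = begin
      T (fsuc r) root + κ root * T (fsuc r) fzero
        ≡⟨ cong₂ (λ x y → x + y * T (fsuc r) fzero) (root-column (fsuc r)) κ-root ⟩
      w (fsuc r) + - w fzero * T (fsuc r) fzero
        ≡⟨ cong (λ x → w (fsuc r) + - w fzero * x) (T₀-below r) ⟩
      w (fsuc r) + - w fzero * (+ 0 - δq₀ r)
        ≡⟨ regroup (w (fsuc r)) (w fzero) (δq₀ r) ⟩
      w′ r ∎

    edge-column′ : ∀ r c → c ≢ fromℕ k → T′ (fsuc r) (fsuc c) ≡ δ (toℕ r) (toℕ c) - δ (toℕ r) (toℕ (reattach (parent (fsuc c))))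
    edge-column′ r c c≢root = begin
      T (fsuc r) (fsuc c) + κ (fsuc c) * T (fsuc r) fzero
        ≡⟨ cong₂ (λ x y → x + y * T (fsuc r) fzero) (edge-column (fsuc r) (fsuc c) 1+c≢root) (κ-edge (fsuc c) 1+c≢root) ⟩
      δ (suc (toℕ r)) (suc (toℕ c)) - δ (suc (toℕ r)) (toℕ p) + δ 0 (toℕ p) * T (fsuc r) fzero
        ≡⟨ cong (λ x → δ (suc (toℕ r)) (suc (toℕ c)) - δ (suc (toℕ r)) (toℕ p) + δ 0 (toℕ p) * x) (T₀-below r) ⟩
      δ (suc (toℕ r)) (suc (toℕ c)) - δ (suc (toℕ r)) (toℕ p) + δ 0 (toℕ p) * (+ 0 - δq₀ r)
        ≡⟨ edge-entry r c p ⟩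
      δ (toℕ r) (toℕ c) - δ (toℕ r) (toℕ (reattach p)) ∎
      where
      p : Fin (suc (suc k))
      p = parent (fsuc c)
      1+c≢root : fsuc c ≢ root
      1+c≢root = c≢root ∘ FinP.suc-injective

  sum-w′ : sumFin w′ ≡ sumFin w
  sum-w′ = begin
    sumFin w′                                      ≡⟨ sumFin-distrib-+ (w ∘ fsuc) (λ r → w fzero * δq₀ r) ⟩
    sumFin (w ∘ fsuc) + sumFin (λ r → w fzero * δq₀ r)
      ≡⟨ cong (_+_ (sumFin (w ∘ fsuc))) (trans (sumFin-*ˡ (w fzero) δq₀) (cong (w fzero *_) (sumFin-δ q₀))) ⟩
    sumFin (w ∘ fsuc) + w fzero * + 1              ≡⟨ swap (sumFin (w ∘ fsuc)) (w fzero) ⟩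
    w fzero + sumFin (w ∘ fsuc)                    ∎
    where
    open ≡-Reasoning
    swap : ∀ x y → x + y * + 1 ≡ y + x
    swap = solve-∀

det-weightedIncidence : ∀ k (t : RootedTree k) w T → IsWeightedIncidence t w T → det (suc k) T ≡ sumFin w
det-weightedIncidence zero t w T T-incidence =
  trans (unit (T fzero fzero)) (trans (root-column fzero) (sym (ℤP.+-identityʳ (w fzero))))
  where
  open IsWeightedIncidence T-incidence
  unit : ∀ x → + 1 * (x * + 1) + + 0 ≡ x
  unit = solve-∀
det-weightedIncidence (suc k) t w T T-incidence with RootedTree.parent t fzero in parent₀
... | fzero  = ⊥-elim (ℕP.<-irrefl (cong height parent₀) (height-parent fzero λ ()))
  where open RootedTree t
... | fsuc q₀ = begin
  det (suc (suc k)) T                  ≡⟨ sym det-T′ ⟩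
  det (suc (suc k)) T′                 ≡⟨ det-firstRowUnit (suc k) T′ T′₀₀ T′₀ⱼ ⟩
  det (suc k) (minor T′ fzero)         ≡⟨ det-weightedIncidence k contracted w′ (minor T′ fzero) minor-incidence ⟩
  sumFin w′                            ≡⟨ sum-w′ ⟩
  sumFin w                             ∎
  where
  open ≡-Reasoning
  open Contraction t w T T-incidence q₀ parent₀

-- Arithmetic modulo d and the circulant matrix

module Modular (e : ℕ) where
  open import Data.Nat.DivMod
  open import Data.Nat.GCD using (module Bézout)
  open import Data.Nat.Coprimality using (Coprime; coprime-Bézout)
  open import Level using (0ℓ)
  open import Relation.Binary.Bundles using (Setoid)
  import Relation.Binary.Reasoning.Setoid

  modulus : ℕ
  modulus = suc e

  infix 4 _≋_
  record _≋_ (x y : ℕ) : Set where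
    constructor mod-eq
    field mod-≡ : x % modulus ≡ y % modulus
  open _≋_ public

  ≋-refl : ∀ {x} → x ≋ x
  ≋-refl = mod-eq refl

  ≋-setoid : Setoid 0ℓ 0ℓ
  ≋-setoid = record
    { Carrier       = ℕ
    ; _≈_           = _≋_
    ; isEquivalence = record
      { refl  = ≋-refl
      ; sym   = λ x≋y → mod-eq (sym (mod-≡ x≋y))
      ; trans = λ x≋y y≋z → mod-eq (trans (mod-≡ x≋y) (mod-≡ y≋z))
      }
    }

  ≡⇒≋ : ∀ {x y} → x ≡ y → x ≋ y
  ≡⇒≋ refl = mod-eq refl

  ≋-+ : ∀ {x y u v} → x ≋ y → u ≋ v → x ℕ.+ u ≋ y ℕ.+ v
  ≋-+ {x} {y} {u} {v} (mod-eq x≋y) (mod-eq u≋v) = mod-eq (begin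
    (x ℕ.+ u) % modulus                          ≡⟨ %-distribˡ-+ x u modulus ⟩
    (x % modulus ℕ.+ u % modulus) % modulus      ≡⟨ cong₂ (λ p q → (p ℕ.+ q) % modulus) x≋y u≋v ⟩
    (y % modulus ℕ.+ v % modulus) % modulus      ≡⟨ sym (%-distribˡ-+ y v modulus) ⟩
    (y ℕ.+ v) % modulus                          ∎)
    where open ≡-Reasoning

  ≋-* : ∀ {x y u v} → x ≋ y → u ≋ v → x ℕ.* u ≋ y ℕ.* v
  ≋-* {x} {y} {u} {v} (mod-eq x≋y) (mod-eq u≋v) = mod-eq (begin
    (x ℕ.* u) % modulus                          ≡⟨ %-distribˡ-* x u modulus ⟩
    (x % modulus ℕ.* (u % modulus)) % modulus    ≡⟨ cong₂ (λ p q → (p ℕ.* q) % modulus) x≋y u≋v ⟩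
    (y % modulus ℕ.* (v % modulus)) % modulus    ≡⟨ sym (%-distribˡ-* y v modulus) ⟩
    (y ℕ.* v) % modulus                          ∎)
    where open ≡-Reasoning

  ≋-+ˡ : ∀ x {u v} → u ≋ v → x ℕ.+ u ≋ x ℕ.+ v
  ≋-+ˡ x = ≋-+ (≋-refl {x})

  ≋-+ʳ : ∀ z {x y} → x ≋ y → x ℕ.+ z ≋ y ℕ.+ z
  ≋-+ʳ z x≋y = ≋-+ x≋y (≋-refl {z})

  ≋-*ʳ : ∀ z {x y} → x ≋ y → x ℕ.* z ≋ y ℕ.* z
  ≋-*ʳ z x≋y = ≋-* x≋y (≋-refl {z})

  %-≋ : ∀ x → x % modulus ≋ x
  %-≋ x = mod-eq (m%n%n≡m%n x modulus)

  *modulus≋0 : ∀ x → x ℕ.* modulus ≋ 0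
  *modulus≋0 x = mod-eq (m*n%n≡0 x modulus)

  modulus≋0 : modulus ≋ 0
  modulus≋0 = mod-eq (n%n≡0 modulus)

  ≋⇒≡ : ∀ {x y} → x ℕ.< modulus → y ℕ.< modulus → x ≋ y → x ≡ y
  ≋⇒≡ x<d y<d (mod-eq x≋y) = trans (sym (m<n⇒m%n≡m x<d)) (trans x≋y (m<n⇒m%n≡m y<d))

  module ≋-Reasoning = Relation.Binary.Reasoning.Setoid ≋-setoid
  open ≋-Reasoning

  +-cancelʳ-≋ : ∀ {x y} t → x ℕ.+ t ≋ y ℕ.+ t → x ≋ y
  +-cancelʳ-≋ {x} {y} zero    eq = begin
    x          ≡⟨ sym (ℕP.+-identityʳ x) ⟩
    x ℕ.+ 0    ≈⟨ eq ⟩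
    y ℕ.+ 0    ≡⟨ ℕP.+-identityʳ y ⟩
    y          ∎
  +-cancelʳ-≋ {x} {y} (suc t) eq = +-cancelʳ-≋ t (begin
    x ℕ.+ t                      ≡⟨ ℕP.+-identityʳ (x ℕ.+ t) ⟨
    x ℕ.+ t ℕ.+ 0                ≈⟨ ≋-+ ≋-refl modulus≋0 ⟨
    x ℕ.+ t ℕ.+ modulus          ≡⟨ shift x ⟩
    x ℕ.+ suc t ℕ.+ e            ≈⟨ ≋-+ eq ≋-refl ⟩
    y ℕ.+ suc t ℕ.+ e            ≡⟨ shift y ⟨
    y ℕ.+ t ℕ.+ modulus          ≈⟨ ≋-+ ≋-refl modulus≋0 ⟩
    y ℕ.+ t ℕ.+ 0                ≡⟨ ℕP.+-identityʳ (y ℕ.+ t) ⟩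
    y ℕ.+ t                      ∎)
    where
    shift : ∀ z → z ℕ.+ t ℕ.+ suc e ≡ z ℕ.+ suc t ℕ.+ e
    shift z = rearrange z t e
      where
      rearrange : ∀ z t e → z ℕ.+ t ℕ.+ suc e ≡ z ℕ.+ suc t ℕ.+ e
      rearrange = ℕ-Solver.solve-∀

  mod-small : ∀ {x} → x ℕ.< modulus → x % modulus ≡ x
  mod-small = m<n⇒m%n≡m

  δ-shift : ∀ x y → y ℕ.< modulus → δ (x % modulus) y ≡ δ (suc x % modulus) (suc y % modulus)
  δ-shift x y y<d = δ-cong to from
    where
    to : x % modulus ≡ y → suc x % modulus ≡ suc y % modulus
    to eq = mod-≡ (≋-+ (≋-refl {1}) (mod-eq (trans eq (sym (mod-small y<d)))))
    from : suc x % modulus ≡ suc y % modulus → x % modulus ≡ y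
    from eq = trans (mod-≡ (+-cancelʳ-≋ 1 (begin
      x ℕ.+ 1     ≡⟨ ℕP.+-comm x 1 ⟩
      suc x       ≈⟨ mod-eq eq ⟩
      suc y       ≡⟨ ℕP.+-comm 1 y ⟩
      y ℕ.+ 1     ∎)))
      (mod-small y<d)

  mod-complement : ∀ x y z → y ℕ.+ z ≡ modulus → x ℕ.< modulus → ((x ℕ.+ y) % modulus ℕ.+ z) % modulus ≡ x
  mod-complement x y z y+z≡d x<d = trans (mod-≡ (begin
    (x ℕ.+ y) % modulus ℕ.+ z      ≈⟨ ≋-+ (%-≋ (x ℕ.+ y)) ≋-refl ⟩
    x ℕ.+ y ℕ.+ z                  ≡⟨ trans (ℕP.+-assoc x y z) (cong (x ℕ.+_) y+z≡d) ⟩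
    x ℕ.+ modulus                  ≈⟨ ≋-+ ≋-refl modulus≋0 ⟩
    x ℕ.+ 0                        ≡⟨ ℕP.+-identityʳ x ⟩
    x                              ∎)) (mod-small x<d)

  suc-≋⇒< : ∀ {x y} → x ℕ.< modulus → y ℕ.< modulus → y ≢ 0 → suc x ≋ y → x ℕ.< y
  suc-≋⇒< {x} {y} x<d y<d y≢0 (mod-eq 1+x≋y) with ℕP.m≤n⇒m<n∨m≡n x<d
  ... | inj₁ 1+x<d = ℕP.≤-reflexive (≋⇒≡ 1+x<d y<d (mod-eq 1+x≋y))
  ... | inj₂ 1+x≡d = ⊥-elim (y≢0 (trans (sym (mod-small y<d)) (trans (sym 1+x≋y) (trans (cong (_% modulus) 1+x≡d) (mod-≡ modulus≋0)))))

  sumFin-δ-rotated : ∀ t (c : Fin modulus) → t ℕ.≤ modulus →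
    sumFin {modulus} (λ i → δ ((toℕ i ℕ.+ t) % modulus) (toℕ c)) ≡ + 1
  sumFin-δ-rotated t c t≤d = trans (sumFin-single _ i₀ others) (trans (cong (λ x → δ x (toℕ c)) i₀-hits) (δ-refl (toℕ c)))
    where
    i₀ : Fin modulus
    i₀ = fromℕ< (m%n<n (toℕ c ℕ.+ (modulus ℕ.∸ t)) modulus)
    i₀-hits : (toℕ i₀ ℕ.+ t) % modulus ≡ toℕ c
    i₀-hits = trans (cong (λ x → (x ℕ.+ t) % modulus) (FinP.toℕ-fromℕ< (m%n<n (toℕ c ℕ.+ (modulus ℕ.∸ t)) modulus)))
                    (mod-complement (toℕ c) (modulus ℕ.∸ t) t (ℕP.m∸n+n≡m t≤d) (FinP.toℕ<n c))
    others : ∀ i → i ≢ i₀ → δ ((toℕ i ℕ.+ t) % modulus) (toℕ c) ≡ + 0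
    others i i≢i₀ = δ-≢ λ hits → i≢i₀ (FinP.toℕ-injective (≋⇒≡ (FinP.toℕ<n i) (FinP.toℕ<n i₀)
      (+-cancelʳ-≋ t (mod-eq {toℕ i ℕ.+ t} {toℕ i₀ ℕ.+ t} (trans hits (sym i₀-hits))))))

  invertible : ∀ {x} → Coprime x modulus → ∃[ u ] u ℕ.* x ≋ 1
  invertible {x} x⊥d with coprime-Bézout x⊥d
  ... | Bézout.+- u y 1+yd≡ux = u , (begin
    u ℕ.* x                   ≡⟨ 1+yd≡ux ⟨
    1 ℕ.+ y ℕ.* modulus       ≈⟨ ≋-+ ≋-refl (*modulus≋0 y) ⟩
    1 ℕ.+ 0                   ∎)
  -- Here u x ≡ −1 ≡ e, so (u e) x ≡ e² ≡ 1.
  ... | Bézout.-+ u y 1+ux≡yd = u ℕ.* e , (begin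
    u ℕ.* e ℕ.* x             ≡⟨ swap-factors u e x ⟩
    u ℕ.* x ℕ.* e             ≈⟨ ≋-* ux≋e ≋-refl ⟩
    e ℕ.* e                   ≡⟨ ℕP.+-identityʳ (e ℕ.* e) ⟨
    e ℕ.* e ℕ.+ 0             ≈⟨ ≋-+ ≋-refl modulus≋0 ⟨
    e ℕ.* e ℕ.+ modulus       ≡⟨ square-identity e ⟩
    1 ℕ.+ e ℕ.* modulus       ≈⟨ ≋-+ ≋-refl (*modulus≋0 e) ⟩
    1 ℕ.+ 0                   ∎)
    where
    swap-factors : ∀ u e x → u ℕ.* e ℕ.* x ≡ u ℕ.* x ℕ.* e
    swap-factors = ℕ-Solver.solve-∀
    square-identity : ∀ e → e ℕ.* e ℕ.+ suc e ≡ 1 ℕ.+ e ℕ.* suc e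
    square-identity = ℕ-Solver.solve-∀
    ux≋e : u ℕ.* x ≋ e
    ux≋e = begin
      u ℕ.* x                     ≡⟨ ℕP.+-identityʳ (u ℕ.* x) ⟨
      u ℕ.* x ℕ.+ 0               ≈⟨ ≋-+ ≋-refl modulus≋0 ⟨
      u ℕ.* x ℕ.+ modulus         ≡⟨ ℕP.+-suc (u ℕ.* x) e ⟩
      suc (u ℕ.* x) ℕ.+ e         ≡⟨ cong (ℕ._+ e) 1+ux≡yd ⟩
      y ℕ.* modulus ℕ.+ e         ≈⟨ ≋-+ (*modulus≋0 y) ≋-refl ⟩
      e                           ∎

module Circulant (a n : ℕ) .{{_ : NonZero n}} where
  m : ℕ
  m = suc a

  open Modular (a ℕ.+ n)
  open import Data.Nat.DivMod using (m%n<n; m<n⇒m%n≡m; m∣n⇒o%n%m≡o%m; %-remove-+ʳ)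
  open import Data.Nat.Divisibility using (_∣_; ∣m∣n⇒∣m+n; ∣m+n∣m⇒∣n; ∣1⇒≡1; m%n≡0⇒n∣m)
  open import Data.Nat.GCD using (gcd; gcd[m,n]∣m; gcd[m,n]∣n; gcd[m,n]≢0)
  import Data.Nat.Coprimality as Coprimality

  d : ℕ
  d = modulus

  M : Matrix d
  M = circMatrix m n

  column-difference : ∀ i (j j′ : Fin d) → suc (toℕ j′) % d ≡ toℕ j →
    M i j - M i j′ ≡ δ (toℕ i) (toℕ j) - δ ((toℕ i ℕ.+ m) % d) (toℕ j)
  column-difference i j j′ next = begin
    M i j - M i j′
      ≡⟨ cong (_-_ (M i j)) (sumFin-cong {m} λ t → trans (δ-shift (toℕ i ℕ.+ toℕ t) (toℕ j′) (FinP.toℕ<n j′)) (cong (δ _) next)) ⟩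
    sumFin {m} (λ t → g (toℕ i ℕ.+ toℕ t)) - sumFin {m} (λ t → g (suc (toℕ i ℕ.+ toℕ t)))
      ≡⟨ sym (sumFin-distrib-− {m} (λ t → g (toℕ i ℕ.+ toℕ t)) (λ t → g (suc (toℕ i ℕ.+ toℕ t)))) ⟩
    sumFin {m} (λ t → g (toℕ i ℕ.+ toℕ t) - g (suc (toℕ i ℕ.+ toℕ t)))
      ≡⟨ sumFin-telescope m g (toℕ i) ⟩
    g (toℕ i) - g (toℕ i ℕ.+ m)
      ≡⟨ cong (λ x → δ x (toℕ j) - g (toℕ i ℕ.+ m)) (mod-small (FinP.toℕ<n i)) ⟩
    δ (toℕ i) (toℕ j) - δ ((toℕ i ℕ.+ m) % d) (toℕ j) ∎
    where
    open ≡-Reasoning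
    g : ℕ → ℤ
    g x = δ (x % d) (toℕ j)

  last : Fin d
  last = fromℕ (a ℕ.+ n)

  fzero≢last : fzero ≢ last
  fzero≢last eq = ℕ.≢-nonZero⁻¹ n (ℕP.m+n≡0⇒n≡0 a (sym (trans (cong toℕ eq) (FinP.toℕ-fromℕ (a ℕ.+ n)))))

  differences : Matrix d
  differences i j with j Fin.≟ last
  ... | yes _ = M i j
  ... | no _  = δ (toℕ i) (toℕ j) - δ ((toℕ i ℕ.+ m) % d) (toℕ j)

  differences-last : ∀ i → differences i last ≡ M i last
  differences-last i with last Fin.≟ last
  ... | yes _        = refl
  ... | no last≢last = ⊥-elim (last≢last refl)

  differences-edge : ∀ i j → j ≢ last → differences i j ≡ δ (toℕ i) (toℕ j) - δ ((toℕ i ℕ.+ m) % d) (toℕ j)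
  differences-edge i j j≢last with j Fin.≟ last
  ... | yes j≡last = ⊥-elim (j≢last j≡last)
  ... | no _       = refl

  -- First every column j ∉ {0, last} gets column j − 1 subtracted, then column 0 gets the last one.
  det-differences : det d differences ≡ det d M
  det-differences = trans (det-addColumn d D₁ differences fzero last (- + 1) fzero≢last agree differences-0)
                          (det-addColumnMultiples d M predecessor κ κ-vanishes)
    where
    predecessor : Fin d → Fin d
    predecessor fzero    = fzero
    predecessor (fsuc j) = inject₁ j

    κ : Fin d → ℤ
    κ j with j Fin.≟ last
    ... | yes _ = + 0
    ... | no _  = step j
      where
      step : Fin d → ℤ
      step fzero    = + 0
      step (fsuc _) = - + 1

    κ-last : κ last ≡ + 0
    κ-last with last Fin.≟ last
    ... | yes _        = refl
    ... | no last≢last = ⊥-elim (last≢last refl)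

    κ-vanishes : ∀ j → toℕ j ℕ.≤ toℕ (predecessor j) → κ j ≡ + 0
    κ-vanishes fzero    _ with fzero Fin.≟ last
    ... | yes _ = refl
    ... | no _  = refl
    κ-vanishes (fsuc j) 1+j≤j = ⊥-elim (ℕP.1+n≰n (subst (suc (toℕ j) ℕ.≤_) (FinP.toℕ-inject₁ j) 1+j≤j))

    D₁ : Matrix d
    D₁ i j = M i j + κ j * M i (predecessor j)

    untouched : ∀ i j → κ j ≡ + 0 → D₁ i j ≡ M i j
    untouched i j κj≡0 = trans (cong (λ x → M i j + x * M i (predecessor j)) κj≡0)
                               (trans (cong (_+_ (M i j)) (ℤP.*-zeroˡ (M i (predecessor j)))) (ℤP.+-identityʳ (M i j)))

    κ-fsuc : ∀ j → fsuc j ≢ last → κ (fsuc j) ≡ - + 1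
    κ-fsuc j j≢last with fsuc j Fin.≟ last
    ... | yes j≡last = ⊥-elim (j≢last j≡last)
    ... | no _       = refl

    minus : ∀ x y → x - y ≡ x + - + 1 * y
    minus x y = cong (_+_ x) (sym (ℤP.-1*i≡-i y))

    agree : AgreeOff fzero differences D₁
    agree i fzero    0≢0 = ⊥-elim (0≢0 refl)
    agree i (fsuc j) _   = by-cases (fsuc j Fin.≟ last)
      where
      next : suc (toℕ (inject₁ j)) % d ≡ toℕ (fsuc j)
      next = trans (cong (λ x → suc x % d) (FinP.toℕ-inject₁ j)) (mod-small (FinP.toℕ<n (fsuc j)))
      by-cases : Dec (fsuc j ≡ last) → differences i (fsuc j) ≡ D₁ i (fsuc j)
      by-cases (yes j≡last) = trans (cong (differences i) j≡last)
        (trans (differences-last i) (sym (trans (cong (D₁ i) j≡last) (untouched i last κ-last))))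
      by-cases (no j≢last) = begin
        differences i (fsuc j)                     ≡⟨ differences-edge i (fsuc j) j≢last ⟩
        δ (toℕ i) (toℕ (fsuc j)) - δ ((toℕ i ℕ.+ m) % d) (toℕ (fsuc j))
                                                   ≡⟨ sym (column-difference i (fsuc j) (inject₁ j) next) ⟩
        M i (fsuc j) - M i (inject₁ j)             ≡⟨ minus (M i (fsuc j)) (M i (inject₁ j)) ⟩
        M i (fsuc j) + - + 1 * M i (inject₁ j)     ≡⟨ cong (λ x → M i (fsuc j) + x * M i (inject₁ j)) (sym (κ-fsuc j j≢last)) ⟩
        D₁ i (fsuc j)                              ∎
        where open ≡-Reasoning

    differences-0 : ∀ i → differences i fzero ≡ D₁ i fzero + - + 1 * D₁ i last
    differences-0 i = begin
      differences i fzero                          ≡⟨ differences-edge i fzero fzero≢last ⟩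
      δ (toℕ i) 0 - δ ((toℕ i ℕ.+ m) % d) 0        ≡⟨ sym (column-difference i fzero last wraps-around) ⟩
      M i fzero - M i last                         ≡⟨ minus (M i fzero) (M i last) ⟩
      M i fzero + - + 1 * M i last
        ≡⟨ cong₂ (λ x y → x + - + 1 * y) (untouched i fzero (κ-vanishes fzero ℕ.z≤n)) (untouched i last κ-last) ⟨
      D₁ i fzero + - + 1 * D₁ i last               ∎
      where
      open ≡-Reasoning
      wraps-around : suc (toℕ last) % d ≡ 0
      wraps-around = trans (cong (λ x → suc x % d) (FinP.toℕ-fromℕ (a ℕ.+ n))) (mod-≡ modulus≋0)

  weight-sum : sumFin (column M last) ≡ + m
  weight-sum = begin
    sumFin {d} (λ i → sumFin {m} (λ t → δ ((toℕ i ℕ.+ toℕ t) % d) (toℕ last)))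
      ≡⟨ sumFin-swap {d} {m} (λ i t → δ ((toℕ i ℕ.+ toℕ t) % d) (toℕ last)) ⟩
    sumFin {m} (λ t → sumFin {d} (λ i → δ ((toℕ i ℕ.+ toℕ t) % d) (toℕ last)))
      ≡⟨ sumFin-cong {m} (λ t → sumFin-δ-rotated (toℕ t) last (ℕP.<⇒≤ (ℕP.<-≤-trans (FinP.toℕ<n t) (ℕP.m≤m+n m n)))) ⟩
    sumFin {m} (λ _ → + 1)
      ≡⟨ sumFin-const-1 m ⟩
    + m ∎
    where open ≡-Reasoning

  δ-parent : ∀ (i v : Fin d) → δ ((toℕ i ℕ.+ m) % d) (toℕ v) ≡ δ (toℕ i) ((toℕ v ℕ.+ n) % d)
  δ-parent i v = δ-cong to from
    where
    to : (toℕ i ℕ.+ m) % d ≡ toℕ v → toℕ i ≡ (toℕ v ℕ.+ n) % d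
    to i+m≡v = sym (trans (cong (λ x → (x ℕ.+ n) % d) (sym i+m≡v)) (mod-complement (toℕ i) m n refl (FinP.toℕ<n i)))
    from : toℕ i ≡ (toℕ v ℕ.+ n) % d → (toℕ i ℕ.+ m) % d ≡ toℕ v
    from i≡v+n = trans (cong (λ x → (x ℕ.+ m) % d) i≡v+n) (mod-complement (toℕ v) n m (ℕP.+-comm n m) (FinP.toℕ<n v))

  -- For gcd m n ≡ 1, the columns of `differences` form the tree v ↦ v − m (mod d) rooted at
  -- last = −1; the height of v is the number of steps to the root, (v + 1) m⁻¹ mod d.
  module CoprimeCase (u : ℕ) (u-inverse : u ℕ.* m ≋ 1) where

    parent : Fin d → Fin d
    parent v = fromℕ< (m%n<n (toℕ v ℕ.+ n) d)

    toℕ-parent : ∀ v → toℕ (parent v) ≡ (toℕ v ℕ.+ n) % d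
    toℕ-parent v = FinP.toℕ-fromℕ< (m%n<n (toℕ v ℕ.+ n) d)

    height : Fin d → ℕ
    height v = (suc (toℕ v) ℕ.* u) % d

    height-parent-≋ : ∀ v → suc (height (parent v)) ≋ height v
    height-parent-≋ v = begin
      1 ℕ.+ (suc (toℕ (parent v)) ℕ.* u) % d      ≈⟨ ≋-+ˡ 1 (%-≋ (suc (toℕ (parent v)) ℕ.* u)) ⟩
      1 ℕ.+ suc (toℕ (parent v)) ℕ.* u            ≡⟨ cong (λ x → 1 ℕ.+ suc x ℕ.* u) (toℕ-parent v) ⟩
      1 ℕ.+ suc ((toℕ v ℕ.+ n) % d) ℕ.* u         ≈⟨ ≋-+ˡ 1 (≋-*ʳ u (≋-+ˡ 1 (%-≋ (toℕ v ℕ.+ n)))) ⟩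
      1 ℕ.+ suc (toℕ v ℕ.+ n) ℕ.* u               ≈⟨ ≋-+ʳ (suc (toℕ v ℕ.+ n) ℕ.* u) u-inverse ⟨
      u ℕ.* m ℕ.+ suc (toℕ v ℕ.+ n) ℕ.* u         ≡⟨ regroup u (toℕ v) ⟩
      suc (toℕ v) ℕ.* u ℕ.+ u ℕ.* d               ≈⟨ ≋-+ˡ (suc (toℕ v) ℕ.* u) (*modulus≋0 u) ⟩
      suc (toℕ v) ℕ.* u ℕ.+ 0                     ≡⟨ ℕP.+-identityʳ (suc (toℕ v) ℕ.* u) ⟩
      suc (toℕ v) ℕ.* u                           ≈⟨ %-≋ (suc (toℕ v) ℕ.* u) ⟨
      height v                                    ∎
      where
      open ≋-Reasoning
      regroup : ∀ u v → u ℕ.* m ℕ.+ suc (v ℕ.+ n) ℕ.* u ≡ suc v ℕ.* u ℕ.+ u ℕ.* d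
      regroup u v = ring a n u v
        where
        ring : ∀ a n u v → u ℕ.* suc a ℕ.+ suc (v ℕ.+ n) ℕ.* u ≡ suc v ℕ.* u ℕ.+ u ℕ.* suc (a ℕ.+ n)
        ring = ℕ-Solver.solve-∀

    height≡0⇒≋0 : ∀ v → height v ≡ 0 → suc (toℕ v) ≋ 0
    height≡0⇒≋0 v h≡0 = begin
      suc (toℕ v)                            ≡⟨ ℕP.*-identityʳ (suc (toℕ v)) ⟨
      suc (toℕ v) ℕ.* 1                      ≈⟨ ≋-* (≋-refl {suc (toℕ v)}) u-inverse ⟨
      suc (toℕ v) ℕ.* (u ℕ.* m)              ≡⟨ ℕP.*-assoc (suc (toℕ v)) u m ⟨
      suc (toℕ v) ℕ.* u ℕ.* m                ≈⟨ ≋-*ʳ m (%-≋ (suc (toℕ v) ℕ.* u)) ⟨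
      height v ℕ.* m                         ≡⟨ cong (ℕ._* m) h≡0 ⟩
      0                                      ∎
      where open ≋-Reasoning

    height≢0 : ∀ v → v ≢ last → height v ≢ 0
    height≢0 v v≢last h≡0 with ℕP.m≤n⇒m<n∨m≡n (FinP.toℕ<n v)
    ... | inj₁ 1+v<d = ℕP.1+n≢0 (trans (sym (mod-small 1+v<d)) (mod-≡ (height≡0⇒≋0 v h≡0)))
    ... | inj₂ 1+v≡d = v≢last (FinP.toℕ-injective (trans (ℕP.suc-injective 1+v≡d) (sym (FinP.toℕ-fromℕ (a ℕ.+ n)))))

    tree : RootedTree (a ℕ.+ n)
    tree = record
      { parent        = parent
      ; height        = height
      ; height-parent = λ v v≢last →
          suc-≋⇒< (m%n<n (suc (toℕ (parent v)) ℕ.* u) d) (m%n<n (suc (toℕ v) ℕ.* u) d) (height≢0 v v≢last) (height-parent-≋ v)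
      }

    incidence : IsWeightedIncidence tree (column M last) differences
    incidence = record
      { root-column = differences-last
      ; edge-column = λ i v v≢last → trans (differences-edge i v v≢last)
          (cong (_-_ (δ (toℕ i) (toℕ v))) (trans (δ-parent i v) (cong (δ (toℕ i)) (sym (toℕ-parent v)))))
      }

    det-M : det d M ≡ + m
    det-M = begin
      det d M                 ≡⟨ det-differences ⟨
      det d differences       ≡⟨ det-weightedIncidence (a ℕ.+ n) tree (column M last) differences incidence ⟩
      sumFin (column M last)  ≡⟨ weight-sum ⟩
      + m                     ∎
      where open ≡-Reasoning

  -- A common divisor G ≥ 2 of m and n divides d, so v ↦ v − m preserves residues mod G; the
  -- columns of `differences` indexed by multiples of G (which avoid last = −1) sum to zero.
  module NonCoprimeCase (G : ℕ) .{{_ : NonZero G}} (G∣m : G ∣ m) (G∣n : G ∣ n) (G≢1 : G ≢ 1) where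
    κ : ℕ → ℤ
    κ y = δ (y % G) 0

    G∣d : G ∣ d
    G∣d = ∣m∣n⇒∣m+n G∣m G∣n

    κ-last : κ (toℕ last) ≡ + 0
    κ-last = δ-≢ λ last%G≡0 → G≢1 (∣1⇒≡1 (∣m+n∣m⇒∣n (subst (G ∣_) (ℕP.+-comm 1 (a ℕ.+ n)) G∣d)
                                                    (subst (G ∣_) (FinP.toℕ-fromℕ (a ℕ.+ n)) (m%n≡0⇒n∣m _ G last%G≡0))))

    κ-0 : κ 0 ≢ + 0
    κ-0 κ0≡0 with trans (sym (cong (λ y → δ y 0) (m<n⇒m%n≡m (ℕ.>-nonZero⁻¹ G)))) κ0≡0
    ... | ()

    dependency : ∀ i → sumFin (λ j → κ (toℕ j) * differences i j) ≡ + 0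
    dependency i = begin
      sumFin {d} (λ j → κ (toℕ j) * differences i j)
        ≡⟨ sumFin-cong {d} (λ j → by-cases j (j Fin.≟ last)) ⟩
      sumFin {d} (λ j → κ (toℕ j) * δ (toℕ i) (toℕ j) - κ (toℕ j) * δ x (toℕ j))
        ≡⟨ sumFin-distrib-− {d} (λ j → κ (toℕ j) * δ (toℕ i) (toℕ j)) (λ j → κ (toℕ j) * δ x (toℕ j)) ⟩
      sumFin {d} (λ j → κ (toℕ j) * δ (toℕ i) (toℕ j)) - sumFin {d} (λ j → κ (toℕ j) * δ x (toℕ j))
        ≡⟨ cong₂ _-_ (sumFin-select κ (toℕ i) (FinP.toℕ<n i)) (sumFin-select κ x (m%n<n (toℕ i ℕ.+ m) d)) ⟩
      κ (toℕ i) - δ (x % G) 0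
        ≡⟨ cong (λ y → κ (toℕ i) - δ y 0) same-residue ⟩
      κ (toℕ i) - κ (toℕ i)
        ≡⟨ ℤP.+-inverseʳ (κ (toℕ i)) ⟩
      + 0 ∎
      where
      open ≡-Reasoning
      x : ℕ
      x = (toℕ i ℕ.+ m) % d
      same-residue : x % G ≡ toℕ i % G
      same-residue = trans (m∣n⇒o%n%m≡o%m G d (toℕ i ℕ.+ m) G∣d) (%-remove-+ʳ (toℕ i) G∣m)
      vanish : ∀ D p q → + 0 * D ≡ + 0 * p - + 0 * q
      vanish = solve-∀
      distrib : ∀ k p q → k * (p - q) ≡ k * p - k * q
      distrib = solve-∀
      by-cases : ∀ j → Dec (j ≡ last) → κ (toℕ j) * differences i j ≡ κ (toℕ j) * δ (toℕ i) (toℕ j) - κ (toℕ j) * δ x (toℕ j)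
      by-cases j (yes refl) = begin
        κ (toℕ last) * differences i last
          ≡⟨ cong (_* differences i last) κ-last ⟩
        + 0 * differences i last
          ≡⟨ vanish (differences i last) (δ (toℕ i) (toℕ last)) (δ x (toℕ last)) ⟩
        + 0 * δ (toℕ i) (toℕ last) - + 0 * δ x (toℕ last)
          ≡⟨ cong (λ k → k * δ (toℕ i) (toℕ last) - k * δ x (toℕ last)) κ-last ⟨
        κ (toℕ last) * δ (toℕ i) (toℕ last) - κ (toℕ last) * δ x (toℕ last) ∎
      by-cases j (no j≢last) =
        trans (cong (κ (toℕ j) *_) (differences-edge i j j≢last)) (distrib (κ (toℕ j)) (δ (toℕ i) (toℕ j)) (δ x (toℕ j)))

    det-M : det d M ≡ + 0
    det-M = trans (sym det-differences) (det-dependentColumns d differences (κ ∘ toℕ) fzero κ-0 dependency)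

  det-coprime : gcd m n ≡ 1 → det d M ≡ + m
  det-coprime gcd≡1 = CoprimeCase.det-M (proj₁ m⁻¹) (proj₂ m⁻¹)
    where
    m⊥d : Coprimality.Coprime m d
    m⊥d = Coprimality.sym (Coprimality.coprime-+ (Coprimality.sym (Coprimality.gcd≡1⇒coprime gcd≡1)))
    m⁻¹ : ∃[ u ] u ℕ.* m ≋ 1
    m⁻¹ = invertible m⊥d

  det-notCoprime : gcd m n ≢ 1 → det d M ≡ + 0
  det-notCoprime gcd≢1 = NonCoprimeCase.det-M (gcd m n) {{gcd≢0}} (gcd[m,n]∣m m n) (gcd[m,n]∣n m n) gcd≢1
    where
    gcd≢0 : NonZero (gcd m n)
    gcd≢0 = ℕ.≢-nonZero (gcd[m,n]≢0 m n (inj₁ λ ()))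

proposition3p1 : (m n : ℕ) → .{{_ : NonZero m}} → .{{_ : NonZero n}} →
    (gcd m n ≡ 1 → (det (m ℕ.+ n) (circMatrix m n) ≡ + m ⊎ det (m ℕ.+ n) (circMatrix m n) ≡ - (+ m)))
    × (gcd m n ≢ 1 → det (m ℕ.+ n) (circMatrix m n) ≡ + 0)
proposition3p1 (suc a) n = (λ gcd≡1 → inj₁ (det-coprime gcd≡1)) , det-notCoprime
  where open Circulant a n
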